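{- Let $\Pi=\{\pi_1,\dots,\pi_d\}\subset\mathrm{Dr}(k,n)$ be a collection of tropical Plücker vectors such that $\pi_i+\pi_j\in\mathrm{Dr}(k,n)$ for all $i,j\in[d]$. Then the cone $\mathrm{cone}(\Pi)=\{c_1\pi_1+\dots+c_d\pi_d: c_1,\dots,c_d\ge 0\}$ is contained in $\mathrm{Dr}(k,n)$.
   Context: The Dressian $\mathrm{Dr}(k,n)\subset\mathbb{R}^{\binom{n}{k}}$ is the set of tropical Plücker vectors: vectors $\pi=(\pi_I)_{I\in\binom{[n]}{k}}$ such that for every $L\in\binom{[n]}{k-2}$ and every $\{a,b,c,d\}\in\binom{[n]}{4}$ with $L\cap\{a,b,c,d\}=\emptyset$, the minimum of $\pi_{Lab}+\pi_{Lcd},\ \pi_{Lac}+\pi_{Lbd},\ \pi_{Lad}+\pi_{Lbc}$ is attained at least twice, where $\pi_{LS}$ denotes the coordinate indexed by $L\cup S$. -}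

module Defs where

open import Level using (Level; _⊔_)
open import Data.Nat using (ℕ) renaming (_+_ to _+ℕ_)
open import Data.Fin using (Fin)
open import Data.Fin.Subset using (Subset; _∪_; ⁅_⁆; _∉_; ∣_∣)
open import Data.Product using (_×_; ∃)
open import Data.Sum using (_⊎_)
open import Relation.Nullary using (¬_)
open import Relation.Binary.PropositionalEquality using (_≡_; _≢_)
open import Relation.Binary.Structures using (IsTotalOrder)
open import Algebra.Bundles using (CommutativeRing)

-- A linearly ordered field: a commutative ring with a total order
-- compatible with + and *, with 0 ≉ 1 and inverses of nonzero elements.
-- The paper works over ℝ, which is an instance.
record OrderedField (c ℓ₁ ℓ₂ : Level) : Set (Level.suc (c ⊔ ℓ₁ ⊔ ℓ₂)) where
  infix 4 _≤_
  field
    commutativeRing : CommutativeRing c ℓ₁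
  open CommutativeRing commutativeRing public
  field
    _≤_           : Carrier → Carrier → Set ℓ₂
    isTotalOrder  : IsTotalOrder _≈_ _≤_
    +-mono-≤      : ∀ {x y} z → x ≤ y → (x + z) ≤ (y + z)
    *-nonneg      : ∀ {x y} → 0# ≤ x → 0# ≤ y → 0# ≤ (x * y)
    0≉1           : ¬ (0# ≈ 1#)
    inverse       : ∀ x → ¬ (x ≈ 0#) → ∃ λ y → (x * y) ≈ 1#

module _ {c ℓ₁ ℓ₂ : Level} (F : OrderedField c ℓ₁ ℓ₂) where
  open OrderedField F using (Carrier; _≈_; _≤_; _+_; _*_; 0#)

  MinTwice : Carrier → Carrier → Carrier → Set (ℓ₁ ⊔ ℓ₂)
  MinTwice x y z = ((x ≈ y) × (x ≤ z)) ⊎ ((x ≈ z) × (x ≤ y)) ⊎ ((y ≈ z) × (y ≤ x))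

  -- A vector in F^(n choose k) is represented as a function on all subsets
  -- of [n]; only its values on k-subsets are ever used.
  Vect : ℕ → Set c
  Vect n = Subset n → Carrier

  InDressian : (k n : ℕ) → Vect n → Set (ℓ₁ ⊔ ℓ₂)
  InDressian k n π =
    (L : Subset n) → ∣ L ∣ +ℕ 2 ≡ k →
    (a b c d : Fin n) →
    a ≢ b → a ≢ c → a ≢ d → b ≢ c → b ≢ d → c ≢ d →
    a ∉ L → b ∉ L → c ∉ L → d ∉ L →
    MinTwice (π (L ∪ ⁅ a ⁆ ∪ ⁅ b ⁆) + π (L ∪ ⁅ c ⁆ ∪ ⁅ d ⁆))
             (π (L ∪ ⁅ a ⁆ ∪ ⁅ c ⁆) + π (L ∪ ⁅ b ⁆ ∪ ⁅ d ⁆))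
             (π (L ∪ ⁅ a ⁆ ∪ ⁅ d ⁆) + π (L ∪ ⁅ b ⁆ ∪ ⁅ c ⁆))

  _⊕_ : ∀ {n} → Vect n → Vect n → Vect n
  (π ⊕ σ) I = π I + σ I

  lincomb : ∀ {n} (d : ℕ) → (Fin d → Carrier) → (Fin d → Vect n) → Vect n
  lincomb ℕ.zero    cs πs I = 0#
  lincomb (ℕ.suc d) cs πs I = (cs Fin.zero * πs Fin.zero I) + lincomb d (λ i → cs (Fin.suc i)) (λ i → πs (Fin.suc i)) I

-- Fix L and a, b, c, d and view each πᵢ's three-term Plücker relation as a
-- triple of numbers whose minimum is attained at a pair of positions. If πᵢ
-- attains it at p and πⱼ at a different pair q, then πᵢ + πⱼ is minimal at the
-- position shared by p and q, so the second occurrence of its minimum forces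
-- πⱼ to attain its minimum at p too, or πᵢ at q. Induction on d then yields a
-- single pair p at which every πᵢ attains its minimum, and "equal on p, at most
-- the remaining entry" is preserved by nonnegative linear combinations.
module Submission where

open import Defs
open import Data.Nat using (ℕ; zero; suc)
open import Data.Fin using (Fin)
open import Data.Fin.Properties using (∀-cons)
open import Data.Fin.Subset using (Subset; _∪_; ⁅_⁆)
open import Data.Product using (_×_; _,_; ∃; proj₁; proj₂)
open import Data.Sum using (_⊎_; inj₁; inj₂)
import Data.Sum as Sum
open import Function using (_∘_)
open import Level using (Level; _⊔_)
open import Relation.Binary.Bundles using (Poset)
import Relation.Binary.PropositionalEquality as ≡
open import Relation.Binary.Structures using (IsTotalOrder)
import Algebra.Properties.AbelianGroup as AbelianGroupProperties
import Algebra.Properties.CommutativeSemigroup as CommutativeSemigroupProperties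
import Algebra.Properties.Group as GroupProperties
import Relation.Binary.Reasoning.PartialOrder as PosetReasoning

∀⊎⇒⊎∀ : ∀ {a b} {A : Set a} {d : ℕ} {B : Fin d → Set b} →
         (∀ i → A ⊎ B i) → A ⊎ (∀ i → B i)
∀⊎⇒⊎∀ {d = zero}  h = inj₂ λ ()
∀⊎⇒⊎∀ {d = suc d} h with h Fin.zero | ∀⊎⇒⊎∀ (h ∘ Fin.suc)
... | inj₁ a  | _      = inj₁ a
... | inj₂ _  | inj₁ a = inj₁ a
... | inj₂ b₀ | inj₂ b = inj₂ (∀-cons b₀ b)

module _ {c ℓ₁ ℓ₂ : Level} (F : OrderedField c ℓ₁ ℓ₂) where
  open OrderedField F
  open IsTotalOrder isTotalOrder
    using (isPartialOrder; antisym)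
    renaming (refl to ≤-refl; reflexive to ≤-reflexive; ≲-respˡ-≈ to ≤-respˡ-≈; ≲-respʳ-≈ to ≤-respʳ-≈)
  open GroupProperties +-group using (∙-cancelˡ; ∙-cancelʳ)
  open AbelianGroupProperties +-abelianGroup using (xyx⁻¹≈y)
  open CommutativeSemigroupProperties +-commutativeSemigroup using (interchange)

  poset : Poset c ℓ₁ ℓ₂
  poset = record { isPartialOrder = isPartialOrder }

  open PosetReasoning poset

  +-mono₂-≤ : ∀ {x y u v} → x ≤ y → u ≤ v → x + u ≤ y + v
  +-mono₂-≤ {x} {y} {u} {v} x≤y u≤v = begin
    x + u  ≤⟨ +-mono-≤ u x≤y ⟩
    y + u  ≈⟨ +-comm y u ⟩
    u + y  ≤⟨ +-mono-≤ y u≤v ⟩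
    v + y  ≈⟨ +-comm v y ⟩
    y + v  ∎

  *-monoˡ-≤-nonneg : ∀ {a x y} → 0# ≤ a → x ≤ y → a * x ≤ a * y
  *-monoˡ-≤-nonneg {a} {x} {y} 0≤a x≤y = begin
    a * x                  ≈⟨ +-identityʳ (a * x) ⟨
    a * x + 0#             ≤⟨ +-mono₂-≤ ≤-refl (*-nonneg 0≤a 0≤y-x) ⟩
    a * x + a * (y - x)    ≈⟨ distribˡ a x (y - x) ⟨
    a * (x + (y - x))      ≈⟨ *-congˡ (trans (sym (+-assoc x y (- x))) (xyx⁻¹≈y x y)) ⟩
    a * y                  ∎
    where
    0≤y-x : 0# ≤ y - x
    0≤y-x = begin
      0#      ≈⟨ -‿inverseʳ x ⟨
      x - x   ≤⟨ +-mono-≤ (- x) x≤y ⟩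
      y - x   ∎

  +-cancelˡ-≈ : ∀ {x y x′ y′} → x + y ≈ x′ + y′ → x ≈ x′ → y ≈ y′
  +-cancelˡ-≈ {x} {y} {x′} {y′} eq x≈x′ = ∙-cancelˡ x y y′ (trans eq (+-congʳ (sym x≈x′)))

  +-cancelʳ-≈ : ∀ {x y x′ y′} → x + y ≈ x′ + y′ → y ≈ y′ → x ≈ x′
  +-cancelʳ-≈ {x} {y} {x′} {y′} eq y≈y′ = ∙-cancelʳ y x x′ (trans eq (+-congˡ (sym y≈y′)))

  data Pair : Set where
    xy xz yz : Pair

  MinAt : Pair → Carrier → Carrier → Carrier → Set (ℓ₁ ⊔ ℓ₂)
  MinAt xy x y z = x ≈ y × x ≤ z
  MinAt xz x y z = x ≈ z × x ≤ y
  MinAt yz x y z = y ≈ z × y ≤ x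

  minTwice⇒minAt : ∀ {x y z} → MinTwice F x y z → ∃ λ p → MinAt p x y z
  minTwice⇒minAt (inj₁ m)        = xy , m
  minTwice⇒minAt (inj₂ (inj₁ m)) = xz , m
  minTwice⇒minAt (inj₂ (inj₂ m)) = yz , m

  minAt⇒minTwice : ∀ p {x y z} → MinAt p x y z → MinTwice F x y z
  minAt⇒minTwice xy m = inj₁ m
  minAt⇒minTwice xz m = inj₂ (inj₁ m)
  minAt⇒minTwice yz m = inj₂ (inj₂ m)

  ≈≤-resp : ∀ {x y z x′ y′ z′} → x ≈ x′ → y ≈ y′ → z ≈ z′ →
            x ≈ y × x ≤ z → x′ ≈ y′ × x′ ≤ z′
  ≈≤-resp x≈x′ y≈y′ z≈z′ (x≈y , x≤z) =
    trans (sym x≈x′) (trans x≈y y≈y′) , ≤-respʳ-≈ z≈z′ (≤-respˡ-≈ x≈x′ x≤z)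

  ≈≤-flip : ∀ {x y z} → x ≈ y × x ≤ z → y ≈ x × y ≤ z
  ≈≤-flip (x≈y , x≤z) = ≈≤-resp x≈y (sym x≈y) refl (x≈y , x≤z)

  minAt-resp : ∀ p {x y z x′ y′ z′} → x ≈ x′ → y ≈ y′ → z ≈ z′ →
               MinAt p x y z → MinAt p x′ y′ z′
  minAt-resp xy x≈x′ y≈y′ z≈z′ = ≈≤-resp x≈x′ y≈y′ z≈z′
  minAt-resp xz x≈x′ y≈y′ z≈z′ = ≈≤-resp x≈x′ z≈z′ y≈y′
  minAt-resp yz x≈x′ y≈y′ z≈z′ = ≈≤-resp y≈y′ z≈z′ x≈x′

  minTwice-resp : ∀ {x y z x′ y′ z′} → x ≈ x′ → y ≈ y′ → z ≈ z′ →
                  MinTwice F x y z → MinTwice F x′ y′ z′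
  minTwice-resp x≈x′ y≈y′ z≈z′ m with minTwice⇒minAt m
  ... | p , mp = minAt⇒minTwice p (minAt-resp p x≈x′ y≈y′ z≈z′ mp)

  swap₁₂ swap₂₃ : Pair → Pair
  swap₁₂ xy = xy
  swap₁₂ xz = yz
  swap₁₂ yz = xz
  swap₂₃ xy = xz
  swap₂₃ xz = xy
  swap₂₃ yz = yz

  minAt-swap₁₂ : ∀ p {x y z} → MinAt p x y z → MinAt (swap₁₂ p) y x z
  minAt-swap₁₂ xy = ≈≤-flip
  minAt-swap₁₂ xz m = m
  minAt-swap₁₂ yz m = m

  minAt-swap₁₂⁻¹ : ∀ p {x y z} → MinAt (swap₁₂ p) y x z → MinAt p x y z
  minAt-swap₁₂⁻¹ xy = ≈≤-flip
  minAt-swap₁₂⁻¹ xz m = m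
  minAt-swap₁₂⁻¹ yz m = m

  minAt-swap₂₃ : ∀ p {x y z} → MinAt p x y z → MinAt (swap₂₃ p) x z y
  minAt-swap₂₃ xy m = m
  minAt-swap₂₃ xz m = m
  minAt-swap₂₃ yz = ≈≤-flip

  minAt-swap₂₃⁻¹ : ∀ p {x y z} → MinAt (swap₂₃ p) x z y → MinAt p x y z
  minAt-swap₂₃⁻¹ xy m = m
  minAt-swap₂₃⁻¹ xz m = m
  minAt-swap₂₃⁻¹ yz = ≈≤-flip

  minTwice-swap₁₂ : ∀ {x y z} → MinTwice F x y z → MinTwice F y x z
  minTwice-swap₁₂ m with minTwice⇒minAt m
  ... | p , mp = minAt⇒minTwice (swap₁₂ p) (minAt-swap₁₂ p mp)

  minTwice-swap₂₃ : ∀ {x y z} → MinTwice F x y z → MinTwice F x z y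
  minTwice-swap₂₃ m with minTwice⇒minAt m
  ... | p , mp = minAt⇒minTwice (swap₂₃ p) (minAt-swap₂₃ p mp)

  Exchange : Pair → Pair → Set (c ⊔ ℓ₁ ⊔ ℓ₂)
  Exchange p q = ∀ {x y z x′ y′ z′} → MinAt p x y z → MinAt q x′ y′ z′ →
                 MinTwice F (x + x′) (y + y′) (z + z′) → MinAt p x′ y′ z′ ⊎ MinAt q x y z

  exchange-refl : ∀ p → Exchange p p
  exchange-refl p _ m′ _ = inj₁ m′

  exchange-comm : ∀ p q → Exchange p q → Exchange q p
  exchange-comm p q ex m m′ m+m′ =
    Sum.swap (ex m′ m (minTwice-resp (+-comm _ _) (+-comm _ _) (+-comm _ _) m+m′))

  exchange-swap₁₂ : ∀ p q → Exchange p q → Exchange (swap₁₂ p) (swap₁₂ q)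
  exchange-swap₁₂ p q ex m m′ m+m′ =
    Sum.map (minAt-swap₁₂ p) (minAt-swap₁₂ q)
      (ex (minAt-swap₁₂⁻¹ p m) (minAt-swap₁₂⁻¹ q m′) (minTwice-swap₁₂ m+m′))

  exchange-swap₂₃ : ∀ p q → Exchange p q → Exchange (swap₂₃ p) (swap₂₃ q)
  exchange-swap₂₃ p q ex m m′ m+m′ =
    Sum.map (minAt-swap₂₃ p) (minAt-swap₂₃ q)
      (ex (minAt-swap₂₃⁻¹ p m) (minAt-swap₂₃⁻¹ q m′) (minTwice-swap₂₃ m+m′))

  -- Whichever other position attains the minimum of the sum together with the
  -- shared first one cancels against one of the two given equalities.
  exchange-xy-xz : Exchange xy xz
  exchange-xy-xz {x} {y} {z} {x′} {y′} {z′} (x≈y , x≤z) (x′≈z′ , x′≤y′) = go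
    where
    x′≈y′-if : x + x′ ≈ y + y′ → MinAt xy x′ y′ z′ ⊎ MinAt xz x y z
    x′≈y′-if eq = inj₁ (+-cancelˡ-≈ eq x≈y , ≤-reflexive x′≈z′)

    go : MinTwice F (x + x′) (y + y′) (z + z′) → MinAt xy x′ y′ z′ ⊎ MinAt xz x y z
    go (inj₁ (eq , _))        = x′≈y′-if eq
    go (inj₂ (inj₁ (eq , _))) = inj₂ (+-cancelʳ-≈ eq x′≈z′ , ≤-reflexive x≈y)
    go (inj₂ (inj₂ (_ , y+y′≤x+x′))) =
      x′≈y′-if (antisym (+-mono₂-≤ (≤-reflexive x≈y) x′≤y′) y+y′≤x+x′)

  exchange-xy-yz : Exchange xy yz
  exchange-xy-yz = exchange-swap₁₂ xy xz exchange-xy-xz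

  exchange-xz-yz : Exchange xz yz
  exchange-xz-yz = exchange-swap₂₃ xy yz exchange-xy-yz

  exchange : ∀ p q → Exchange p q
  exchange xy xy = exchange-refl xy
  exchange xz xz = exchange-refl xz
  exchange yz yz = exchange-refl yz
  exchange xy xz = exchange-xy-xz
  exchange xy yz = exchange-xy-yz
  exchange xz yz = exchange-xz-yz
  exchange xz xy = exchange-comm xy xz exchange-xy-xz
  exchange yz xy = exchange-comm xy yz exchange-xy-yz
  exchange yz xz = exchange-comm xz yz exchange-xz-yz

  commonMinAt : ∀ d (x y z : Fin d → Carrier) →
                (∀ i → MinTwice F (x i) (y i) (z i)) →
                (∀ i j → MinTwice F (x i + x j) (y i + y j) (z i + z j)) →
                ∃ λ p → ∀ i → MinAt p (x i) (y i) (z i)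
  commonMinAt zero    x y z _ _ = xy , λ ()
  commonMinAt (suc d) x y z each pairs
    with commonMinAt d (x ∘ Fin.suc) (y ∘ Fin.suc) (z ∘ Fin.suc)
                       (each ∘ Fin.suc) (λ i j → pairs (Fin.suc i) (Fin.suc j))
       | minTwice⇒minAt (each Fin.zero)
  ... | p , tail | q , head
    with ∀⊎⇒⊎∀ (λ i → exchange p q (tail i) head (pairs (Fin.suc i) Fin.zero))
  ... | inj₁ head-p = p , ∀-cons head-p tail
  ... | inj₂ tail-q = q , ∀-cons head tail-q

  weightedSum : ∀ d → (Fin d → Carrier) → (Fin d → Carrier) → Carrier
  weightedSum zero    cs x = 0#
  weightedSum (suc d) cs x = cs Fin.zero * x Fin.zero + weightedSum d (cs ∘ Fin.suc) (x ∘ Fin.suc)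

  weightedSum-+ : ∀ d cs (x y : Fin d → Carrier) →
                  weightedSum d cs (λ i → x i + y i) ≈ weightedSum d cs x + weightedSum d cs y
  weightedSum-+ zero    cs x y = sym (+-identityˡ 0#)
  weightedSum-+ (suc d) cs x y = begin-equality
    cs₀ * (x₀ + y₀) + weightedSum d (cs ∘ Fin.suc) (λ i → x (Fin.suc i) + y (Fin.suc i))
      ≈⟨ +-cong (distribˡ cs₀ x₀ y₀) (weightedSum-+ d (cs ∘ Fin.suc) (x ∘ Fin.suc) (y ∘ Fin.suc)) ⟩
    (cs₀ * x₀ + cs₀ * y₀) + (weightedSum d (cs ∘ Fin.suc) (x ∘ Fin.suc) + weightedSum d (cs ∘ Fin.suc) (y ∘ Fin.suc))
      ≈⟨ interchange _ _ _ _ ⟩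
    weightedSum (suc d) cs x + weightedSum (suc d) cs y ∎
    where
    cs₀ = cs Fin.zero
    x₀ = x Fin.zero
    y₀ = y Fin.zero

  weightedSum-cong : ∀ d cs {x y : Fin d → Carrier} → (∀ i → x i ≈ y i) →
                     weightedSum d cs x ≈ weightedSum d cs y
  weightedSum-cong zero    cs x≈y = refl
  weightedSum-cong (suc d) cs x≈y =
    +-cong (*-congˡ (x≈y Fin.zero)) (weightedSum-cong d (cs ∘ Fin.suc) (x≈y ∘ Fin.suc))

  weightedSum-mono : ∀ d {cs} → (∀ i → 0# ≤ cs i) → {x y : Fin d → Carrier} → (∀ i → x i ≤ y i) →
                     weightedSum d cs x ≤ weightedSum d cs y
  weightedSum-mono zero    cs≥0 x≤y = ≤-refl
  weightedSum-mono (suc d) cs≥0 x≤y =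
    +-mono₂-≤ (*-monoˡ-≤-nonneg (cs≥0 Fin.zero) (x≤y Fin.zero))
              (weightedSum-mono d (cs≥0 ∘ Fin.suc) (x≤y ∘ Fin.suc))

  ≈≤-weightedSum : ∀ d {cs} → (∀ i → 0# ≤ cs i) → {x y z : Fin d → Carrier} →
                   (∀ i → x i ≈ y i × x i ≤ z i) →
                   weightedSum d cs x ≈ weightedSum d cs y × weightedSum d cs x ≤ weightedSum d cs z
  ≈≤-weightedSum d {cs} cs≥0 h = weightedSum-cong d cs (proj₁ ∘ h) , weightedSum-mono d cs≥0 (proj₂ ∘ h)

  minAt-weightedSum : ∀ p d {cs} → (∀ i → 0# ≤ cs i) → {x y z : Fin d → Carrier} →
                      (∀ i → MinAt p (x i) (y i) (z i)) →
                      MinAt p (weightedSum d cs x) (weightedSum d cs y) (weightedSum d cs z)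
  minAt-weightedSum xy d cs≥0 = ≈≤-weightedSum d cs≥0
  minAt-weightedSum xz d cs≥0 = ≈≤-weightedSum d cs≥0
  minAt-weightedSum yz d cs≥0 = ≈≤-weightedSum d cs≥0

  minTwice-weightedSum : ∀ d {cs} → (∀ i → 0# ≤ cs i) → (x y z : Fin d → Carrier) →
                         (∀ i → MinTwice F (x i) (y i) (z i)) →
                         (∀ i j → MinTwice F (x i + x j) (y i + y j) (z i + z j)) →
                         MinTwice F (weightedSum d cs x) (weightedSum d cs y) (weightedSum d cs z)
  minTwice-weightedSum d cs≥0 x y z each pairs with commonMinAt d x y z each pairs
  ... | p , all-p = minAt⇒minTwice p (minAt-weightedSum p d cs≥0 all-p)

  lincomb-pointwise : ∀ {n} d cs (πs : Fin d → Vect F n) I →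
                      lincomb F d cs πs I ≡.≡ weightedSum d cs (λ i → πs i I)
  lincomb-pointwise zero    cs πs I = ≡.refl
  lincomb-pointwise (suc d) cs πs I =
    ≡.cong (cs Fin.zero * πs Fin.zero I +_) (lincomb-pointwise d (cs ∘ Fin.suc) (πs ∘ Fin.suc) I)

  pairSum : ∀ {n} → Subset n → Subset n → Vect F n → Carrier
  pairSum I J π = π I + π J

  pairSum-⊕ : ∀ {n} I J (π σ : Vect F n) →
              pairSum I J (_⊕_ F π σ) ≈ pairSum I J π + pairSum I J σ
  pairSum-⊕ I J π σ = interchange (π I) (σ I) (π J) (σ J)

  pairSum-lincomb : ∀ {n} d cs (πs : Fin d → Vect F n) I J →
                    weightedSum d cs (pairSum I J ∘ πs) ≈ pairSum I J (lincomb F d cs πs)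
  pairSum-lincomb d cs πs I J
    rewrite lincomb-pointwise d cs πs I | lincomb-pointwise d cs πs J =
    weightedSum-+ d cs (λ i → πs i I) (λ i → πs i J)

lemma3p3 : {c ℓ₁ ℓ₂ : Level} (F : OrderedField c ℓ₁ ℓ₂) (k n d : ℕ)
    (πs : Fin d → Vect F n) →
    (∀ i → InDressian F k n (πs i)) →
    (∀ i j → InDressian F k n (_⊕_ F (πs i) (πs j))) →
    (cs : Fin d → OrderedField.Carrier F) →
    (∀ i → OrderedField._≤_ F (OrderedField.0# F) (cs i)) →
    InDressian F k n (lincomb F d cs πs)
lemma3p3 F k n d πs πs∈Dr sums∈Dr cs cs≥0 L ∣L∣+2≡k a b c d′ a≢b a≢c a≢d b≢c b≢d c≢d a∉L b∉L c∉L d∉L =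
  minTwice-resp F (pairSum-lincomb F d cs πs ab cd) (pairSum-lincomb F d cs πs ac bd)
                  (pairSum-lincomb F d cs πs ad bc)
    (minTwice-weightedSum F d cs≥0 (x ∘ πs) (y ∘ πs) (z ∘ πs) (λ i → relation (πs i) (πs∈Dr i)) relation-+)
  where
  open OrderedField F using (Carrier; _+_)

  ab cd ac bd ad bc : Subset n
  ab = L ∪ ⁅ a ⁆ ∪ ⁅ b ⁆
  cd = L ∪ ⁅ c ⁆ ∪ ⁅ d′ ⁆
  ac = L ∪ ⁅ a ⁆ ∪ ⁅ c ⁆
  bd = L ∪ ⁅ b ⁆ ∪ ⁅ d′ ⁆
  ad = L ∪ ⁅ a ⁆ ∪ ⁅ d′ ⁆
  bc = L ∪ ⁅ b ⁆ ∪ ⁅ c ⁆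

  x y z : Vect F n → Carrier
  x = pairSum F ab cd
  y = pairSum F ac bd
  z = pairSum F ad bc

  relation : ∀ π → InDressian F k n π → MinTwice F (x π) (y π) (z π)
  relation π π∈Dr = π∈Dr L ∣L∣+2≡k a b c d′ a≢b a≢c a≢d b≢c b≢d c≢d a∉L b∉L c∉L d∉L

  relation-+ : ∀ i j → MinTwice F (x (πs i) + x (πs j)) (y (πs i) + y (πs j)) (z (πs i) + z (πs j))
  relation-+ i j =
    minTwice-resp F (pairSum-⊕ F ab cd (πs i) (πs j)) (pairSum-⊕ F ac bd (πs i) (πs j))
                    (pairSum-⊕ F ad bc (πs i) (πs j))
                    (relation (_⊕_ F (πs i) (πs j)) (sums∈Dr i j))
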